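{- Let $e$ be a positive integer, let $n = 2e-1$, $q = 2^{n}$, and let $Q : V \to W$ be a crooked function, where $V$ and $W$ are $n$-dimensional vector spaces over $\mathbb{F}_2$. Let $G_Q$ be the corresponding crooked graph (on $2q^2$ vertices) and let $I_1, \dots, I_{2q}$ be its fibres. Let $H \in \mathcal{W}_5$ be a graph with $q$ vertices. Let $G_Q''$ be any graph obtained from $G_Q$ by adding edges inside each fibre $I_j$ so that the subgraph of $G_Q''$ induced on $I_j$ is isomorphic to $H$ (for every $j$), and adding no other edges. Then $G_Q'' \in \mathcal{W}_5$.
   Context: All graphs are finite and simple. For an integer $t \ge 1$, $\mathcal{W}_t$ denotes the class of graphs other than stars (graphs $K_{1,m}$) that have diameter $2$ and contain neither a triangle nor a $K_{2,t}$ as a subgraph. A function $Q : V \to W$ between $n$-dimensional $\mathbb{F}_2$-vector spaces is crooked if (1) $Q(0)=0$; (2) $\sum_{i=1}^4 Q(x_i) \neq 0$ for all distinct $x_1,x_2,x_3,x_4 \in V$ with $x_1+x_2+x_3+x_4 = 0$; and (3) $\sum_{i=1}^3 (Q(x_i) + Q(x_i+a)) \neq 0$ for all $x_1,x_2,x_3 \in V$ and $a \in V\setminus\{0\}$. The crooked graph $G_Q$ has vertex set $V \times \mathbb{F}_2 \times W$, where distinct vertices $(a,i,\alpha)$ and $(b,j,\beta)$ are adjacent iff $\alpha + \beta = Q(a+b) + (i+j+1)(Q(a)+Q(b))$. The fibres of $G_Q$ are the $2q$ sets $I_{(a,i)} = \{(a,i,\alpha) : \alpha \in W\}$ for $(a,i)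 \in V \times \mathbb{F}_2$ (enumerated as $I_1,\dots,I_{2q}$), i.e. the fibres of the map $(a,i,\alpha)\mapsto(a,i)$. -}

module Defs where

open import Data.Nat using (ℕ; zero; suc; _*_; _∸_; _^_; _≤_)
open import Data.Bool using (Bool; true; false; _xor_; if_then_else_)
open import Data.Vec using (Vec; zipWith; replicate)
open import Data.Fin using (Fin)
open import Data.Product using (Σ; ∃; ∃-syntax; _×_; _,_)
open import Data.Sum using (_⊎_)
open import Relation.Nullary using (¬_)
open import Relation.Binary.PropositionalEquality using (_≡_; _≢_)
open import Function.Definitions using (Injective; Bijective)

record Graph (V : Set) : Set where
  field
    adj    : V → V → Bool
    adj-sym    : ∀ u v → adj u v ≡ adj v u
    adj-irrefl : ∀ v → adj v v ≡ false
open Graph public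

module _ {V : Set} (G : Graph V) where

  IsStar : Set
  IsStar = ∃[ c ] ((∀ v → v ≢ c → adj G c v ≡ true)
                 × (∀ u v → u ≢ c → v ≢ c → adj G u v ≡ false))

  Diameter2 : Set
  Diameter2 =
    (∀ u v → u ≢ v → adj G u v ≡ true ⊎ (∃[ w ] (adj G u w ≡ true × adj G w v ≡ true)))
    × (∃[ u ] ∃[ v ] (u ≢ v × adj G u v ≡ false))

  TriangleFree : Set
  TriangleFree = ∀ u v w → ¬ (adj G u v ≡ true × adj G v w ≡ true × adj G u w ≡ true)

  HasK2 : ℕ → Set
  HasK2 t = ∃[ u ] ∃[ v ] Σ (Fin t → V) λ f →
    u ≢ v × Injective _≡_ _≡_ f ×
    (∀ i → f i ≢ u × f i ≢ v × adj G u (f i) ≡ true × adj G v (f i) ≡ true)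

  InW : ℕ → Set
  InW t = ¬ IsStar × Diameter2 × TriangleFree × ¬ HasK2 t

Vecn : ℕ → Set
Vecn n = Vec Bool n

_⊕_ : ∀ {n} → Vecn n → Vecn n → Vecn n
_⊕_ = zipWith _xor_
infixl 6 _⊕_

𝟎 : ∀ {n} → Vecn n
𝟎 = replicate _ false

_·_ : ∀ {n} → Bool → Vecn n → Vecn n
b · x = if b then x else 𝟎

Crooked : (n : ℕ) → (Vecn n → Vecn n) → Set
Crooked n Q =
  (Q 𝟎 ≡ 𝟎)
  × (∀ x₁ x₂ x₃ x₄ → x₁ ≢ x₂ → x₁ ≢ x₃ → x₁ ≢ x₄ → x₂ ≢ x₃ → x₂ ≢ x₄ → x₃ ≢ x₄ →
       x₁ ⊕ x₂ ⊕ x₃ ⊕ x₄ ≡ 𝟎 → Q x₁ ⊕ Q x₂ ⊕ Q x₃ ⊕ Q x₄ ≢ 𝟎)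
  × (∀ x₁ x₂ x₃ a → a ≢ 𝟎 →
       (Q x₁ ⊕ Q (x₁ ⊕ a)) ⊕ (Q x₂ ⊕ Q (x₂ ⊕ a)) ⊕ (Q x₃ ⊕ Q (x₃ ⊕ a)) ≢ 𝟎)

CVertex : ℕ → Set
CVertex n = Vecn n × Bool × Vecn n

CAdj : ∀ {n} → (Vecn n → Vecn n) → CVertex n → CVertex n → Set
CAdj Q (a , i , α) (b , j , β) =
  (a , i , α) ≢ (b , j , β) ×
  (α ⊕ β ≡ Q (a ⊕ b) ⊕ ((i xor j xor true) · (Q a ⊕ Q b)))

fibre : ∀ {n} → CVertex n → Vecn n × Bool
fibre (a , i , α) = (a , i)

-- G'' is obtained from G_Q by adding, inside every fibre I_(a,i), edges
-- forming a copy of H, and no other edges: edges between different fibres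
-- are exactly those of G_Q, and the subgraph induced on each fibre
-- (G_Q has no edges inside a fibre) is isomorphic to H.
IsFibreExtension : ∀ {n} → (Vecn n → Vecn n) → Graph (Fin (2 ^ n)) → Graph (CVertex n) → Set
IsFibreExtension {n} Q H G'' =
  (∀ x y → fibre x ≢ fibre y →
     (adj G'' x y ≡ true → CAdj Q x y) × (CAdj Q x y → adj G'' x y ≡ true))
  × (∀ a i → Σ (Vecn n → Fin (2 ^ n)) λ φ →
       Bijective _≡_ _≡_ φ ×
       (∀ α β → adj G'' (a , i , α) (a , i , β) ≡ adj H (φ α) (φ β)))

-- Between distinct fibres f and g, adjacency in G_Q says that the labels of the two
-- vertices differ by edgeLabel f g; so every vertex has exactly one G_Q-neighbour in
-- each other fibre, and x ∈ I_f, y ∈ I_g have a common neighbour in I_h iff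
-- label x ⊕ label y ≡ pathLabel f g h. The two crookedness conditions say exactly that
-- h ↦ pathLabel f g h is at most two-to-one; since it sends 2q fibres to q labels it is
-- also onto. Ontoness gives distance at most 2 across fibres; two-to-one-ness rules out
-- triangles meeting three fibres and K₂,₅'s with centres in different fibres (at most
-- one spoke in each centre's fibre and at most two elsewhere). Inside a fibre G'' is a
-- copy of H, and a triangle or K₂,₅ that meets a fibre twice and leaves it would give
-- one vertex two neighbours in that fibre.

module Submission where

open import Data.Bool using (Bool; true; false; _xor_; not; if_then_else_) renaming (_≟_ to _≟ᵇ_)
open import Data.Bool.Properties
  using (xor-assoc; xor-comm; xor-same; xor-identityˡ; xor-identityʳ; not-distribˡ-xor; not-distribʳ-xor; not-¬)
open import Data.Empty using (⊥; ⊥-elim)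
open import Data.Fin using (Fin)
import Data.Fin as Fin
open import Data.Fin.Patterns
open import Data.List using (List; []; _∷_; length; filter; map; _++_)
open import Data.List.Membership.Propositional using (_∈_; lose)
open import Data.List.Membership.Propositional.Properties
  using (∈-filter⁺; ∈-filter⁻; ∈-map⁺; ∈-map⁻; ∈-++⁺ˡ; ∈-++⁺ʳ)
open import Data.List.Properties using (length-map; length-++; filter-notAll)
open import Data.List.Relation.Unary.All using ([]; _∷_)
open import Data.List.Relation.Unary.AllPairs using ([]; _∷_)
open import Data.List.Relation.Unary.Any using (here; there; any?; satisfied)
open import Data.List.Relation.Unary.Unique.Propositional using (Unique)
import Data.List.Relation.Unary.Unique.Propositional.Properties as Uniqueₚ
open import Data.Nat using (ℕ; zero; suc; _+_; _*_; _∸_; _^_; _≤_; _<_; s≤s; _≤?_; s≤s⁻¹)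
open import Data.Nat.Properties
  using (+-identityʳ; +-suc; *-suc; +-monoˡ-≤; +-cancelˡ-<; *-monoʳ-<; ≤-refl; ≰⇒>; module ≤-Reasoning)
open import Data.Product using (Σ; ∃; ∃-syntax; _×_; _,_; proj₁; proj₂)
import Data.Product.Properties as ×ₚ
open import Data.Sum using (_⊎_; inj₁; inj₂)
open import Data.Vec using (Vec; []; _∷_; lookup)
open import Data.Vec.Properties using (zipWith-assoc; zipWith-comm; zipWith-identityˡ; zipWith-identityʳ)
import Data.Vec.Properties as Vecₚ
open import Function using (_∘_; _$_)
open import Relation.Binary using (DecidableEquality)
open import Relation.Binary.PropositionalEquality
open import Relation.Nullary using (¬_; Dec; yes; no; does; proof)
open import Relation.Nullary.Decidable using (True; toWitness; ¬?; _⊎-dec_)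
open import Relation.Nullary.Reflects using (invert)
open import Relation.Unary using (Decidable)
open import Relation.Unary.Properties using (∁?)

open import Defs

private variable
  n : ℕ

-- Arithmetic in F₂^n

⊕-assoc : (x y z : Vecn n) → (x ⊕ y) ⊕ z ≡ x ⊕ (y ⊕ z)
⊕-assoc = zipWith-assoc xor-assoc

⊕-comm : (x y : Vecn n) → x ⊕ y ≡ y ⊕ x
⊕-comm = zipWith-comm xor-comm

⊕-identityˡ : (x : Vecn n) → 𝟎 ⊕ x ≡ x
⊕-identityˡ = zipWith-identityˡ xor-identityˡ

⊕-identityʳ : (x : Vecn n) → x ⊕ 𝟎 ≡ x
⊕-identityʳ = zipWith-identityʳ xor-identityʳ

⊕-self : (x : Vecn n) → x ⊕ x ≡ 𝟎
⊕-self []      = refl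
⊕-self (b ∷ x) = cong₂ _∷_ (xor-same b) (⊕-self x)

·-distribʳ-xor : ∀ b c (x : Vecn n) → (b xor c) · x ≡ b · x ⊕ c · x
·-distribʳ-xor true  true  x = sym (⊕-self x)
·-distribʳ-xor true  false x = sym (⊕-identityʳ x)
·-distribʳ-xor false c     x = sym (⊕-identityˡ (c · x))

⊕-interchange : (w x y z : Vecn n) → (w ⊕ x) ⊕ (y ⊕ z) ≡ (w ⊕ y) ⊕ (x ⊕ z)
⊕-interchange w x y z = begin
  (w ⊕ x) ⊕ (y ⊕ z)  ≡⟨ ⊕-assoc w x (y ⊕ z) ⟩
  w ⊕ (x ⊕ (y ⊕ z))  ≡⟨ cong (w ⊕_) (sym (⊕-assoc x y z)) ⟩
  w ⊕ ((x ⊕ y) ⊕ z)  ≡⟨ cong (λ t → w ⊕ (t ⊕ z)) (⊕-comm x y) ⟩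
  w ⊕ ((y ⊕ x) ⊕ z)  ≡⟨ cong (w ⊕_) (⊕-assoc y x z) ⟩
  w ⊕ (y ⊕ (x ⊕ z))  ≡⟨ sym (⊕-assoc w y (x ⊕ z)) ⟩
  (w ⊕ y) ⊕ (x ⊕ z)  ∎
  where open ≡-Reasoning

·-complement : ∀ s (x : Vecn n) → s · x ⊕ not s · x ≡ x
·-complement true  x = ⊕-identityʳ x
·-complement false x = ⊕-identityˡ x

infix 4 _≟_
_≟_ : DecidableEquality (Vecn n)
_≟_ = Vecₚ.≡-dec _≟ᵇ_

-- A decision procedure for identities between ⊕-sums: an expression in k
-- variables is normalised to its coefficient vector in F₂^k.
module ⊕-Solver {n : ℕ} where

  infixl 6 _⊞_
  data Term (k : ℕ) : Set where
    #_  : Fin k → Term k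
    𝟘   : Term k
    _⊞_ : Term k → Term k → Term k

  ⟦_⟧ : ∀ {k} → Term k → Vec (Vecn n) k → Vecn n
  ⟦ # i   ⟧ ρ = lookup ρ i
  ⟦ 𝟘     ⟧ ρ = 𝟎
  ⟦ s ⊞ t ⟧ ρ = ⟦ s ⟧ ρ ⊕ ⟦ t ⟧ ρ

  unit : ∀ {k} → Fin k → Vecn k
  unit 0F          = true ∷ 𝟎
  unit (Fin.suc i) = false ∷ unit i

  normal : ∀ {k} → Term k → Vecn k
  normal (# i)   = unit i
  normal 𝟘       = 𝟎
  normal (s ⊞ t) = normal s ⊕ normal t

  combination : ∀ {k} → Vecn k → Vec (Vecn n) k → Vecn n
  combination []       []      = 𝟎
  combination (b ∷ bs) (x ∷ ρ) = b · x ⊕ combination bs ρ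

  combination-𝟎 : ∀ {k} (ρ : Vec (Vecn n) k) → combination 𝟎 ρ ≡ 𝟎
  combination-𝟎 []      = refl
  combination-𝟎 (x ∷ ρ) = trans (⊕-identityˡ _) (combination-𝟎 ρ)

  combination-unit : ∀ {k} (i : Fin k) (ρ : Vec (Vecn n) k) → combination (unit i) ρ ≡ lookup ρ i
  combination-unit 0F          (x ∷ ρ) = trans (cong (x ⊕_) (combination-𝟎 ρ)) (⊕-identityʳ x)
  combination-unit (Fin.suc i) (x ∷ ρ) = trans (⊕-identityˡ _) (combination-unit i ρ)

  combination-⊕ : ∀ {k} (bs cs : Vecn k) (ρ : Vec (Vecn n) k) →
                  combination (bs ⊕ cs) ρ ≡ combination bs ρ ⊕ combination cs ρ
  combination-⊕ []       []       []      = sym (⊕-identityˡ 𝟎)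
  combination-⊕ (b ∷ bs) (c ∷ cs) (x ∷ ρ) =
    trans (cong₂ _⊕_ (·-distribʳ-xor b c x) (combination-⊕ bs cs ρ)) (⊕-interchange _ _ _ _)

  normal-sound : ∀ {k} (t : Term k) (ρ : Vec (Vecn n) k) → ⟦ t ⟧ ρ ≡ combination (normal t) ρ
  normal-sound (# i)   ρ = sym (combination-unit i ρ)
  normal-sound 𝟘       ρ = sym (combination-𝟎 ρ)
  normal-sound (s ⊞ t) ρ =
    trans (cong₂ _⊕_ (normal-sound s ρ) (normal-sound t ρ)) (sym (combination-⊕ (normal s) (normal t) ρ))

  solve : ∀ {k} (s t : Term k) {_ : True (normal s ≟ normal t)} (ρ : Vec (Vecn n) k) → ⟦ s ⟧ ρ ≡ ⟦ t ⟧ ρ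
  solve s t {same} ρ =
    trans (normal-sound s ρ) (trans (cong (λ c → combination c ρ) (toWitness same)) (sym (normal-sound t ρ)))

open ⊕-Solver

⊕≡𝟎⇒≡ : {x y : Vecn n} → x ⊕ y ≡ 𝟎 → x ≡ y
⊕≡𝟎⇒≡ {x = x} {y} x⊕y≡𝟎 = begin
  x            ≡⟨ solve (# 0F) ((# 0F ⊞ # 1F) ⊞ # 1F) (x ∷ y ∷ []) ⟩
  (x ⊕ y) ⊕ y  ≡⟨ cong (_⊕ y) x⊕y≡𝟎 ⟩
  𝟎 ⊕ y        ≡⟨ ⊕-identityˡ y ⟩
  y            ∎
  where open ≡-Reasoning

≡⇒⊕≡𝟎 : {x y : Vecn n} → x ≡ y → x ⊕ y ≡ 𝟎
≡⇒⊕≡𝟎 {x = x} refl = ⊕-self x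

⊕-cancelʳ : {x y : Vecn n} (z : Vecn n) → x ⊕ z ≡ y ⊕ z → x ≡ y
⊕-cancelʳ {x = x} {y} z eq = ⊕≡𝟎⇒≡ (begin
  x ⊕ y              ≡⟨ solve (# 0F ⊞ # 1F) ((# 0F ⊞ # 2F) ⊞ (# 1F ⊞ # 2F)) (x ∷ y ∷ z ∷ []) ⟩
  (x ⊕ z) ⊕ (y ⊕ z)  ≡⟨ ≡⇒⊕≡𝟎 eq ⟩
  𝟎                  ∎)
  where open ≡-Reasoning

⊕-transpose : {x y z w : Vecn n} → x ⊕ y ≡ z ⊕ w → w ≡ y ⊕ (x ⊕ z)
⊕-transpose {x = x} {y} {z} {w} eq = ⊕≡𝟎⇒≡ (begin
  w ⊕ (y ⊕ (x ⊕ z))  ≡⟨ solve (# 3F ⊞ (# 1F ⊞ (# 0F ⊞ # 2F))) ((# 0F ⊞ # 1F) ⊞ (# 2F ⊞ # 3F))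
                              (x ∷ y ∷ z ∷ w ∷ []) ⟩
  (x ⊕ y) ⊕ (z ⊕ w)  ≡⟨ ≡⇒⊕≡𝟎 eq ⟩
  𝟎                  ∎)
  where open ≡-Reasoning

⊕-cancelˡ : {x y : Vecn n} (z : Vecn n) → z ⊕ x ≡ z ⊕ y → x ≡ y
⊕-cancelˡ {x = x} {y} z eq = ⊕-cancelʳ z (trans (⊕-comm x z) (trans eq (⊕-comm z y)))

-- Counting

true≢false : true ≢ false
true≢false ()

two-of-three : ∀ (k₁ k₂ k₃ : Bool) → k₁ ≡ k₂ ⊎ k₁ ≡ k₃ ⊎ k₂ ≡ k₃
two-of-three true  true  _     = inj₁ refl
two-of-three false false _     = inj₁ refl
two-of-three true  false true  = inj₂ (inj₁ refl)
two-of-three false true  false = inj₂ (inj₁ refl)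
two-of-three true  false false = inj₂ (inj₂ refl)
two-of-three false true  true  = inj₂ (inj₂ refl)

ThreeDistinct : {A : Set} → (A → Set) → Set
ThreeDistinct {A} P =
  Σ A λ x → Σ A λ y → Σ A λ z → x ≢ y × x ≢ z × y ≢ z × P x × P y × P z

ThreeDistinct-map : {A : Set} {P R : A → Set} → (∀ {x} → P x → R x) → ThreeDistinct P → ThreeDistinct R
ThreeDistinct-map g (x , y , z , x≢y , x≢z , y≢z , px , py , pz) =
  x , y , z , x≢y , x≢z , y≢z , g px , g py , g pz

ThreeDistinct-∈ : {A : Set} {zs : List A} → Unique zs → 3 ≤ length zs → ThreeDistinct (_∈ zs)
ThreeDistinct-∈ {zs = x ∷ y ∷ z ∷ _} ((x≢y ∷ x≢z ∷ _) ∷ (y≢z ∷ _) ∷ _) _ =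
  x , y , z , x≢y , x≢z , y≢z , here refl , there (here refl) , there (there (here refl))
ThreeDistinct-∈ {zs = []}              _ ()
ThreeDistinct-∈ {zs = _ ∷ []}          _ (s≤s ())
ThreeDistinct-∈ {zs = _ ∷ _ ∷ []}      _ (s≤s (s≤s ()))

module _ {A : Set} {P : A → Set} (P? : Decidable P) where

  length-filter+∁ : ∀ xs → length (filter P? xs) + length (filter (∁? P?) xs) ≡ length xs
  length-filter+∁ []       = refl
  length-filter+∁ (x ∷ xs) with does (P? x)
  ... | true  = cong suc (length-filter+∁ xs)
  ... | false = trans (+-suc _ _) (cong suc (length-filter+∁ xs))

module _ {A B : Set} (_≟ᴮ_ : DecidableEquality B) (f : A → B) where

  private
    lands? : (b : B) → Decidable (λ x → f x ≡ b)
    lands? b x = f x ≟ᴮ b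

  pigeonhole₂ : ∀ {xs} ys → Unique xs → (∀ {x} → x ∈ xs → f x ∈ ys) → 2 * length ys < length xs →
                ∃[ b ] ThreeDistinct (λ x → x ∈ xs × f x ≡ b)
  pigeonhole₂ {x ∷ _} []       _    into _ with () ← into (here refl)
  pigeonhole₂ {xs}    (y ∷ ys) uniq into crowded with 3 ≤? length (filter (lands? y) xs)
  ... | yes three =
    y , ThreeDistinct-map (∈-filter⁻ (lands? y)) (ThreeDistinct-∈ (Uniqueₚ.filter⁺ (lands? y) uniq) three)
  ... | no  ≤two  =
    let b , triple = pigeonhole₂ ys (Uniqueₚ.filter⁺ (∁? (lands? y)) uniq) into′ crowded′
    in b , ThreeDistinct-map (λ (x∈ , fx≡b) → proj₁ (∈-filter⁻ (∁? (lands? y)) x∈) , fx≡b) triple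
    where
      misses : List A
      misses = filter (∁? (lands? y)) xs

      into′ : ∀ {x} → x ∈ misses → f x ∈ ys
      into′ x∈ with ∈-filter⁻ (∁? (lands? y)) x∈
      ... | x∈xs , fx≢y with into x∈xs
      ...   | here fx≡y = ⊥-elim (fx≢y fx≡y)
      ...   | there fx∈ys = fx∈ys

      crowded′ : 2 * length ys < length misses
      crowded′ = +-cancelˡ-< 2 (2 * length ys) (length misses) (begin-strict
        2 + 2 * length ys                               ≡⟨ sym (*-suc 2 (length ys)) ⟩
        2 * suc (length ys)                             <⟨ crowded ⟩
        length xs                                       ≡⟨ sym (length-filter+∁ (lands? y) xs) ⟩
        length (filter (lands? y) xs) + length misses   ≤⟨ +-monoˡ-≤ (length misses) (s≤s⁻¹ (≰⇒> ≤two)) ⟩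
        2 + length misses                               ∎)
        where open ≤-Reasoning

¬ThreeDistinct-⊎ : {A : Set} {P R : A → Set} →
  (∀ {x y} → x ≢ y → P x → P y → ⊥) → (∀ {x y} → x ≢ y → R x → R y → ⊥) →
  ¬ ThreeDistinct (λ x → P x ⊎ R x)
¬ThreeDistinct-⊎ oneP oneR (_ , _ , _ , x≢y , x≢z , y≢z , px , py , pz) with px | py | pz
... | inj₁ p | inj₁ q | _      = oneP x≢y p q
... | inj₁ p | inj₂ _ | inj₁ r = oneP x≢z p r
... | inj₁ _ | inj₂ q | inj₂ r = oneR y≢z q r
... | inj₂ p | inj₂ q | _      = oneR x≢y p q
... | inj₂ p | inj₁ _ | inj₂ r = oneR x≢z p r
... | inj₂ _ | inj₁ q | inj₁ r = oneP y≢z q r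

dec-invert : {P : Set} (P? : Dec P) {b : Bool} → does P? ≡ b → if b then P else ¬ P
dec-invert P? refl = invert (proof P?)

three-of-five : {P : Fin 5 → Set} → Decidable P → ThreeDistinct P ⊎ ThreeDistinct (¬_ ∘ P)
three-of-five P? with pigeonhole₂ _≟ᵇ_ (does ∘ P?) (true ∷ false ∷ [])
                        (Uniqueₚ.allFin⁺ 5) (λ {k} _ → bothBools (does (P? k))) ≤-refl
  where
    bothBools : ∀ b → b ∈ true ∷ false ∷ []
    bothBools true  = here refl
    bothBools false = there (here refl)
... | true  , triple = inj₁ (ThreeDistinct-map (λ {k} (_ , eq) → dec-invert (P? k) eq) triple)
... | false , triple = inj₂ (ThreeDistinct-map (λ {k} (_ , eq) → dec-invert (P? k) eq) triple)

cube : (m : ℕ) → List (Vecn m)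
cube zero    = [] ∷ []
cube (suc m) = map (true ∷_) (cube m) ++ map (false ∷_) (cube m)

∈-cube : (x : Vecn n) → x ∈ cube n
∈-cube []          = here refl
∈-cube (true  ∷ x) = ∈-++⁺ˡ (∈-map⁺ (true ∷_) (∈-cube x))
∈-cube (false ∷ x) = ∈-++⁺ʳ _ (∈-map⁺ (false ∷_) (∈-cube x))

cube-unique : ∀ m → Unique (cube m)
cube-unique zero    = [] ∷ []
cube-unique (suc m) = Uniqueₚ.++⁺ (half true) (half false) disjoint
  where
    half : ∀ b → Unique (map (b ∷_) (cube m))
    half b = Uniqueₚ.map⁺ (proj₂ ∘ Vecₚ.∷-injective) (cube-unique m)

    disjoint : ∀ {v} → ¬ (v ∈ map (true ∷_) (cube m) × v ∈ map (false ∷_) (cube m))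
    disjoint (v∈ , v∈′) with ∈-map⁻ (true ∷_) v∈ | ∈-map⁻ (false ∷_) v∈′
    ... | _ , _ , refl | _ , _ , ()

length-cube : ∀ m → length (cube m) ≡ 2 ^ m
length-cube zero    = refl
length-cube (suc m) = begin
  length (map (true ∷_) (cube m) ++ map (false ∷_) (cube m))  ≡⟨ length-++ (map (true ∷_) (cube m)) ⟩
  length (map (true ∷_) (cube m)) + length (map (false ∷_) (cube m))
    ≡⟨ cong₂ _+_ (length-map (true ∷_) (cube m)) (length-map (false ∷_) (cube m)) ⟩
  length (cube m) + length (cube m)                            ≡⟨ cong (λ l → l + l) (length-cube m) ⟩
  2 ^ m + 2 ^ m                                                ≡⟨ cong (2 ^ m +_) (sym (+-identityʳ (2 ^ m))) ⟩
  2 ^ suc m                                                    ∎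
  where open ≡-Reasoning

atMostTwoToOne⇒surjective : {A : Set} (xs : List A) → Unique xs →
  ∀ {m} → length xs ≡ 2 * 2 ^ m → (f : A → Vecn m) →
  (∀ w → ¬ ThreeDistinct (λ x → f x ≡ w)) → ∀ w → ∃ λ x → f x ≡ w
atMostTwoToOne⇒surjective xs uniq {m} size f atMost2 w with any? (λ x → f x ≟ w) xs
... | yes hit = satisfied hit
... | no  miss =
  let b , triple = pigeonhole₂ _≟_ f targets uniq into crowded
  in ⊥-elim (atMost2 b (ThreeDistinct-map proj₂ triple))
  where
    targets : List (Vecn m)
    targets = filter (λ v → ¬? (v ≟ w)) (cube m)

    into : ∀ {x} → x ∈ xs → f x ∈ targets
    into {x} x∈ = ∈-filter⁺ (λ v → ¬? (v ≟ w)) (∈-cube (f x)) (λ fx≡w → miss (lose x∈ fx≡w))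

    few : length targets < 2 ^ m
    few = subst (length targets <_) (length-cube m)
            (filter-notAll (λ v → ¬? (v ≟ w)) (cube m) (lose (∈-cube w) (λ w≢w → w≢w refl)))

    crowded : 2 * length targets < length xs
    crowded = subst (2 * length targets <_) (sym size) (*-monoʳ-< 2 few)

-- The crooked graph G_Q

Fibre : ℕ → Set
Fibre n = Vecn n × Bool

toFibre : Vecn (suc n) → Fibre n
toFibre (i ∷ a) = a , i

toFibre-injective : {u v : Vecn (suc n)} → toFibre u ≡ toFibre v → u ≡ v
toFibre-injective {u = _ ∷ _} {_ ∷ _} eq = cong₂ _∷_ (cong proj₂ eq) (cong proj₁ eq)

fibres : (n : ℕ) → List (Fibre n)
fibres n = map toFibre (cube (suc n))

fibres-unique : ∀ n → Unique (fibres n)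
fibres-unique n = Uniqueₚ.map⁺ toFibre-injective (cube-unique (suc n))

length-fibres : ∀ n → length (fibres n) ≡ 2 * 2 ^ n
length-fibres n = trans (length-map _ (cube (suc n))) (length-cube (suc n))

label : CVertex n → Vecn n
label (_ , _ , α) = α

vertex-≡ : {v w : CVertex n} → fibre v ≡ fibre w → label v ≡ label w → v ≡ w
vertex-≡ refl refl = refl

module CrookedGraph {n : ℕ} (Q : Vecn n → Vecn n) where

  edgeLabel : Fibre n → Fibre n → Vecn n
  edgeLabel (a , i) (b , j) = Q (a ⊕ b) ⊕ ((i xor j xor true) · (Q a ⊕ Q b))

  pathLabel : Fibre n → Fibre n → Fibre n → Vecn n
  pathLabel f g h = edgeLabel f h ⊕ edgeLabel g h

  edgeLabel-sym : ∀ f g → edgeLabel f g ≡ edgeLabel g f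
  edgeLabel-sym (a , true)  (b , true)  = cong₂ _⊕_ (cong Q (⊕-comm a b)) (⊕-comm (Q a) (Q b))
  edgeLabel-sym (a , false) (b , false) = cong₂ _⊕_ (cong Q (⊕-comm a b)) (⊕-comm (Q a) (Q b))
  edgeLabel-sym (a , true)  (b , false) = cong (_⊕ 𝟎) (cong Q (⊕-comm a b))
  edgeLabel-sym (a , false) (b , true)  = cong (_⊕ 𝟎) (cong Q (⊕-comm a b))

  edgeLabel-self : Q 𝟎 ≡ 𝟎 → ∀ f → edgeLabel f f ≡ 𝟎
  edgeLabel-self Q𝟎≡𝟎 (a , i) = begin
    Q (a ⊕ a) ⊕ ((i xor i xor true) · (Q a ⊕ Q a))  ≡⟨ cong₂ _⊕_ (cong Q (⊕-self a)) (scalar i) ⟩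
    Q 𝟎 ⊕ 𝟎                                         ≡⟨ cong (_⊕ 𝟎) Q𝟎≡𝟎 ⟩
    𝟎 ⊕ 𝟎                                           ≡⟨ ⊕-self 𝟎 ⟩
    𝟎                                               ∎
    where
      open ≡-Reasoning
      scalar : ∀ i → (i xor i xor true) · (Q a ⊕ Q a) ≡ 𝟎
      scalar true  = ⊕-self (Q a)
      scalar false = ⊕-self (Q a)

  pathLabel-sameLevel : ∀ a b c i k →
    pathLabel (a , i) (b , i) (c , k) ≡ (Q (a ⊕ c) ⊕ Q (b ⊕ c)) ⊕ (i xor k xor true) · (Q a ⊕ Q b)
  pathLabel-sameLevel a b c i k = Qc-cancels (i xor k xor true)
    where
      Qc-cancels : ∀ s → (Q (a ⊕ c) ⊕ s · (Q a ⊕ Q c)) ⊕ (Q (b ⊕ c) ⊕ s · (Q b ⊕ Q c))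
                         ≡ (Q (a ⊕ c) ⊕ Q (b ⊕ c)) ⊕ s · (Q a ⊕ Q b)
      Qc-cancels true  = solve ((# 0F ⊞ (# 2F ⊞ # 4F)) ⊞ (# 1F ⊞ (# 3F ⊞ # 4F))) ((# 0F ⊞ # 1F) ⊞ (# 2F ⊞ # 3F))
                               (Q (a ⊕ c) ∷ Q (b ⊕ c) ∷ Q a ∷ Q b ∷ Q c ∷ [])
      Qc-cancels false = solve ((# 0F ⊞ 𝟘) ⊞ (# 1F ⊞ 𝟘)) ((# 0F ⊞ # 1F) ⊞ 𝟘) (Q (a ⊕ c) ∷ Q (b ⊕ c) ∷ [])

  pathLabel-crossLevel : ∀ a b c c′ i k →
    pathLabel (a , i) (b , i) (c , k) ⊕ pathLabel (a , i) (b , i) (c′ , not k)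
      ≡ (Q (a ⊕ c) ⊕ Q (b ⊕ c)) ⊕ (Q (a ⊕ c′) ⊕ Q (b ⊕ c′)) ⊕ (Q a ⊕ Q b)
  pathLabel-crossLevel a b c c′ i k = begin
    pathLabel (a , i) (b , i) (c , k) ⊕ pathLabel (a , i) (b , i) (c′ , not k)
      ≡⟨ cong₂ _⊕_ (pathLabel-sameLevel a b c i k) (pathLabel-sameLevel a b c′ i (not k)) ⟩
    (L ⊕ s · D) ⊕ (L′ ⊕ (i xor not k xor true) · D)
      ≡⟨ cong (λ t → (L ⊕ s · D) ⊕ (L′ ⊕ t · D)) (sym not-s) ⟩
    (L ⊕ s · D) ⊕ (L′ ⊕ not s · D)
      ≡⟨ ⊕-interchange L (s · D) L′ (not s · D) ⟩
    (L ⊕ L′) ⊕ (s · D ⊕ not s · D)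
      ≡⟨ cong (L ⊕ L′ ⊕_) (·-complement s D) ⟩
    L ⊕ L′ ⊕ D ∎
    where
      open ≡-Reasoning
      L  = Q (a ⊕ c) ⊕ Q (b ⊕ c)
      L′ = Q (a ⊕ c′) ⊕ Q (b ⊕ c′)
      D  = Q a ⊕ Q b
      s  = i xor k xor true
      not-s : not s ≡ i xor not k xor true
      not-s = trans (not-distribʳ-xor i (k xor true)) (cong (i xor_) (not-distribˡ-xor k true))

  pathLabel-swap : ∀ f g h h′ → pathLabel f g h ⊕ pathLabel f g h′ ≡ pathLabel h h′ f ⊕ pathLabel h h′ g
  pathLabel-swap f g h h′ = begin
    (edgeLabel f h ⊕ edgeLabel g h) ⊕ (edgeLabel f h′ ⊕ edgeLabel g h′)
      ≡⟨ ⊕-interchange _ _ _ _ ⟩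
    (edgeLabel f h ⊕ edgeLabel f h′) ⊕ (edgeLabel g h ⊕ edgeLabel g h′)
      ≡⟨ cong₂ _⊕_ (cong₂ _⊕_ (edgeLabel-sym f h) (edgeLabel-sym f h′))
                   (cong₂ _⊕_ (edgeLabel-sym g h) (edgeLabel-sym g h′)) ⟩
    (edgeLabel h f ⊕ edgeLabel h′ f) ⊕ (edgeLabel h g ⊕ edgeLabel h′ g) ∎
    where open ≡-Reasoning

  CAdj-unique : ∀ {x y y′} → CAdj Q x y → CAdj Q x y′ → fibre y ≡ fibre y′ → y ≡ y′
  CAdj-unique {_ , _ , α} {b , j , _} {.b , .j , _} (_ , eq) (_ , eq′) refl =
    cong (λ β → b , j , β) (⊕-cancelˡ α (trans eq (sym eq′)))

  CAdj-commonNeighbour : ∀ {x y z} → CAdj Q x z → CAdj Q y z →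
    pathLabel (fibre x) (fibre y) (fibre z) ≡ label x ⊕ label y
  CAdj-commonNeighbour {_ , _ , α} {_ , _ , β} {_ , _ , γ} (_ , eq) (_ , eq′) = begin
    _                  ≡⟨ cong₂ _⊕_ (sym eq) (sym eq′) ⟩
    (α ⊕ γ) ⊕ (β ⊕ γ)  ≡⟨ solve ((# 0F ⊞ # 2F) ⊞ (# 1F ⊞ # 2F)) (# 0F ⊞ # 1F) (α ∷ β ∷ γ ∷ []) ⟩
    α ⊕ β              ∎
    where open ≡-Reasoning

  module _ (crooked : Crooked n Q) where

    private
      Q𝟎≡𝟎 : Q 𝟎 ≡ 𝟎
      Q𝟎≡𝟎 = proj₁ crooked

    -- If c′ ≢ c ⊕ (a ⊕ b), then a ⊕ c, b ⊕ c, a ⊕ c′, b ⊕ c′ are four distinct points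
    -- with sum 𝟎 whose Q-values also sum to 𝟎.
    sameLevel-collision-shift : ∀ {a b c c′ i k} → a ≢ b → c ≢ c′ →
      pathLabel (a , i) (b , i) (c , k) ≡ pathLabel (a , i) (b , i) (c′ , k) → c′ ≡ c ⊕ (a ⊕ b)
    sameLevel-collision-shift {a} {b} {c} {c′} {i} {k} a≢b c≢c′ eq with c′ ≟ c ⊕ (a ⊕ b)
    ... | yes c′≡ = c′≡
    ... | no  c′≢ = ⊥-elim $ proj₁ (proj₂ crooked) (a ⊕ c) (b ⊕ c) (a ⊕ c′) (b ⊕ c′)
                      (a≢b ∘ ⊕-cancelʳ c) (c≢c′ ∘ ⊕-cancelˡ a) (c′≢ ∘ ⊕-transpose)
                      (c′≢ ∘ (λ e → trans (⊕-transpose e) (cong (c ⊕_) (⊕-comm b a))))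
                      (c≢c′ ∘ ⊕-cancelˡ b) (a≢b ∘ ⊕-cancelʳ c′)
                      (solve ((# 0F ⊞ # 2F) ⊞ (# 1F ⊞ # 2F) ⊞ (# 0F ⊞ # 3F) ⊞ (# 1F ⊞ # 3F)) 𝟘
                             (a ∷ b ∷ c ∷ c′ ∷ []))
                      Q-sum
      where
        Q-sum : Q (a ⊕ c) ⊕ Q (b ⊕ c) ⊕ Q (a ⊕ c′) ⊕ Q (b ⊕ c′) ≡ 𝟎
        Q-sum = trans (⊕-assoc (Q (a ⊕ c) ⊕ Q (b ⊕ c)) (Q (a ⊕ c′)) (Q (b ⊕ c′)))
                  (≡⇒⊕≡𝟎 (⊕-cancelʳ ((i xor k xor true) · (Q a ⊕ Q b))
                    (trans (sym (pathLabel-sameLevel a b c i k)) (trans eq (pathLabel-sameLevel a b c′ i k)))))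

    sameLevel-noCollision-crossLevel : ∀ {a b c c′ i k} → a ≢ b →
      pathLabel (a , i) (b , i) (c , k) ≢ pathLabel (a , i) (b , i) (c′ , not k)
    sameLevel-noCollision-crossLevel {a} {b} {c} {c′} {i} {k} a≢b eq =
      proj₂ (proj₂ crooked) (a ⊕ c) (a ⊕ c′) a (a ⊕ b) (a≢b ∘ ⊕≡𝟎⇒≡) (begin
        (Q (a ⊕ c) ⊕ Q ((a ⊕ c) ⊕ (a ⊕ b))) ⊕ (Q (a ⊕ c′) ⊕ Q ((a ⊕ c′) ⊕ (a ⊕ b))) ⊕ (Q a ⊕ Q (a ⊕ (a ⊕ b)))
          ≡⟨ cong₂ _⊕_ (cong₂ _⊕_ (cong (λ t → Q (a ⊕ c) ⊕ Q t) (shift c))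
                                  (cong (λ t → Q (a ⊕ c′) ⊕ Q t) (shift c′)))
                       (cong (λ t → Q a ⊕ Q t) (solve (# 0F ⊞ (# 0F ⊞ # 1F)) (# 1F) (a ∷ b ∷ []))) ⟩
        (Q (a ⊕ c) ⊕ Q (b ⊕ c)) ⊕ (Q (a ⊕ c′) ⊕ Q (b ⊕ c′)) ⊕ (Q a ⊕ Q b)
          ≡⟨ sym (pathLabel-crossLevel a b c c′ i k) ⟩
        pathLabel (a , i) (b , i) (c , k) ⊕ pathLabel (a , i) (b , i) (c′ , not k)
          ≡⟨ ≡⇒⊕≡𝟎 eq ⟩
        𝟎 ∎)
      where
        open ≡-Reasoning
        shift : ∀ x → (a ⊕ x) ⊕ (a ⊕ b) ≡ b ⊕ x
        shift x = solve ((# 0F ⊞ # 2F) ⊞ (# 0F ⊞ # 1F)) (# 1F ⊞ # 2F) (a ∷ b ∷ x ∷ [])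

    sameLevel-collision : ∀ {a b c c′ i k k′} → a ≢ b → (c , k) ≢ (c′ , k′) →
      pathLabel (a , i) (b , i) (c , k) ≡ pathLabel (a , i) (b , i) (c′ , k′) → k′ ≡ k × c′ ≡ c ⊕ (a ⊕ b)
    sameLevel-collision {i = i} {true} {true} a≢b h≢h′ eq =
      refl , sameLevel-collision-shift {i = i} {true} a≢b (h≢h′ ∘ cong (_, true)) eq
    sameLevel-collision {i = i} {false} {false} a≢b h≢h′ eq =
      refl , sameLevel-collision-shift {i = i} {false} a≢b (h≢h′ ∘ cong (_, false)) eq
    sameLevel-collision {i = i} {true}  {false} a≢b _ eq =
      ⊥-elim (sameLevel-noCollision-crossLevel {i = i} {true} a≢b eq)
    sameLevel-collision {i = i} {false} {true}  a≢b _ eq =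
      ⊥-elim (sameLevel-noCollision-crossLevel {i = i} {false} a≢b eq)

    -- Exchanging the roles of {f , g} and {h , h′} reduces this to the same-level case.
    crossLevel-noCollision-sameLevel : ∀ {a b c c′ i j k} → i ≢ j → (c , k) ≢ (c′ , k) →
      pathLabel (a , i) (b , j) (c , k) ≢ pathLabel (a , i) (b , j) (c′ , k)
    crossLevel-noCollision-sameLevel {a} {b} {c} {c′} {i} {j} {k} i≢j h≢h′ eq =
      i≢j (sym (proj₁ (sameLevel-collision {i = k} (h≢h′ ∘ cong (_, k)) (i≢j ∘ cong proj₂) swapped)))
      where
        swapped : pathLabel (c , k) (c′ , k) (a , i) ≡ pathLabel (c , k) (c′ , k) (b , j)
        swapped = ⊕≡𝟎⇒≡ (trans (sym (pathLabel-swap (a , i) (b , j) (c , k) (c′ , k))) (≡⇒⊕≡𝟎 eq))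

    pathLabel-atMost2 : ∀ {f g} → f ≢ g → ∀ w → ¬ ThreeDistinct (λ h → pathLabel f g h ≡ w)
    pathLabel-atMost2 {a , i} {b , j} f≢g w
      ((c₁ , k₁) , (c₂ , k₂) , (c₃ , k₃) , h₁≢h₂ , h₁≢h₃ , h₂≢h₃ , e₁ , e₂ , e₃) with i ≟ᵇ j
    ... | yes refl =
      let k₂≡k₁ , c₂≡ = sameLevel-collision {i = i} (f≢g ∘ cong (_, i)) h₁≢h₂ (trans e₁ (sym e₂))
          k₃≡k₁ , c₃≡ = sameLevel-collision {i = i} (f≢g ∘ cong (_, i)) h₁≢h₃ (trans e₁ (sym e₃))
      in h₂≢h₃ (cong₂ _,_ (trans c₂≡ (sym c₃≡)) (trans k₂≡k₁ (sym k₃≡k₁)))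
    ... | no i≢j with two-of-three k₁ k₂ k₃
    ...   | inj₁ refl        = crossLevel-noCollision-sameLevel {a} {b} i≢j h₁≢h₂ (trans e₁ (sym e₂))
    ...   | inj₂ (inj₁ refl) = crossLevel-noCollision-sameLevel {a} {b} i≢j h₁≢h₃ (trans e₁ (sym e₃))
    ...   | inj₂ (inj₂ refl) = crossLevel-noCollision-sameLevel {a} {b} i≢j h₂≢h₃ (trans e₂ (sym e₃))

    pathLabel-surjective : ∀ {f g} → f ≢ g → ∀ w → ∃ λ h → pathLabel f g h ≡ w
    pathLabel-surjective {f} {g} f≢g =
      atMostTwoToOne⇒surjective (fibres n) (fibres-unique n) (length-fibres n) (pathLabel f g)
        (pathLabel-atMost2 f≢g)

    pathLabel-atFirst : ∀ f g → pathLabel f g f ≡ edgeLabel f g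
    pathLabel-atFirst f g = begin
      edgeLabel f f ⊕ edgeLabel g f  ≡⟨ cong (_⊕ edgeLabel g f) (edgeLabel-self Q𝟎≡𝟎 f) ⟩
      𝟎 ⊕ edgeLabel g f              ≡⟨ ⊕-identityˡ _ ⟩
      edgeLabel g f                  ≡⟨ edgeLabel-sym g f ⟩
      edgeLabel f g                  ∎
      where open ≡-Reasoning

    pathLabel-atSecond : ∀ f g → pathLabel f g g ≡ edgeLabel f g
    pathLabel-atSecond f g = trans (cong (edgeLabel f g ⊕_) (edgeLabel-self Q𝟎≡𝟎 g)) (⊕-identityʳ _)

    CAdj-triangleFree : ∀ {x y z} → fibre x ≢ fibre y → fibre x ≢ fibre z → fibre y ≢ fibre z →
      CAdj Q x y → CAdj Q x z → CAdj Q y z → ⊥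
    CAdj-triangleFree {x@(a , i , α)} {y@(b , j , β)} {z} fx≢fy fx≢fz fy≢fz (_ , eq) xz yz =
      pathLabel-atMost2 fx≢fy (α ⊕ β)
        ( (a , i) , (b , j) , fibre z , fx≢fy , fx≢fz , fy≢fz
        , trans (pathLabel-atFirst (a , i) (b , j)) (sym eq)
        , trans (pathLabel-atSecond (a , i) (b , j)) (sym eq)
        , CAdj-commonNeighbour {x} {y} {z} xz yz )

    CAdj-distance≤2 : ∀ {x y} → fibre x ≢ fibre y →
      CAdj Q x y ⊎ ∃ λ z → fibre x ≢ fibre z × fibre z ≢ fibre y × CAdj Q x z × CAdj Q z y
    CAdj-distance≤2 {a , i , α} {b , j , β} f≢g with α ⊕ β ≟ edgeLabel (a , i) (b , j)
    ... | yes adjacent = inj₁ (f≢g ∘ cong fibre , adjacent)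
    ... | no  ¬adjacent with pathLabel-surjective f≢g (α ⊕ β)
    ...   | h@(c , k) , eq =
      inj₂ ((c , k , γ) , f≢h , h≢g , (f≢h ∘ cong fibre , x∼z) , (h≢g ∘ cong fibre , z∼y))
      where
        f g : Fibre n
        f = a , i
        g = b , j

        γ : Vecn n
        γ = α ⊕ edgeLabel f h

        f≢h : f ≢ h
        f≢h refl = ¬adjacent (trans (sym eq) (pathLabel-atFirst f g))

        h≢g : h ≢ g
        h≢g refl = ¬adjacent (trans (sym eq) (pathLabel-atSecond f g))

        x∼z : α ⊕ γ ≡ edgeLabel f h
        x∼z = solve (# 0F ⊞ (# 0F ⊞ # 1F)) (# 1F) (α ∷ edgeLabel f h ∷ [])

        z∼y : γ ⊕ β ≡ edgeLabel h g
        z∼y = begin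
          γ ⊕ β                        ≡⟨ solve ((# 0F ⊞ # 2F) ⊞ # 1F) (# 3F ⊞ ((# 2F ⊞ # 3F) ⊞ (# 0F ⊞ # 1F)))
                                                (α ∷ β ∷ edgeLabel f h ∷ edgeLabel g h ∷ []) ⟩
          edgeLabel g h ⊕ (pathLabel f g h ⊕ (α ⊕ β))  ≡⟨ cong (λ t → edgeLabel g h ⊕ t) (≡⇒⊕≡𝟎 eq) ⟩
          edgeLabel g h ⊕ 𝟎            ≡⟨ ⊕-identityʳ _ ⟩
          edgeLabel g h                ≡⟨ edgeLabel-sym g h ⟩
          edgeLabel h g                ∎
          where open ≡-Reasoning

-- Copies of H in the fibres

module FibreExtension {n : ℕ} (Q : Vecn n → Vecn n) (crooked : Crooked n Q)
  (H : Graph (Fin (2 ^ n))) (H∈𝒲₅ : InW H 5) (G : Graph (CVertex n)) (ext : IsFibreExtension Q H G) where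

  open CrookedGraph Q

  private
    H-diameter2 : Diameter2 H
    H-diameter2 = proj₁ (proj₂ H∈𝒲₅)

    H-triangleFree : TriangleFree H
    H-triangleFree = proj₁ (proj₂ (proj₂ H∈𝒲₅))

    H-noK₂₅ : ¬ HasK2 H 5
    H-noK₂₅ = proj₂ (proj₂ (proj₂ H∈𝒲₅))

    _≟ᶠ_ : DecidableEquality (Fibre n)
    _≟ᶠ_ = ×ₚ.≡-dec _≟_ _≟ᵇ_

  infix 4 _∼_
  _∼_ : CVertex n → CVertex n → Set
  x ∼ y = adj G x y ≡ true

  ∼-sym : ∀ {x y} → x ∼ y → y ∼ x
  ∼-sym {x} {y} = trans (adj-sym G y x)

  ∼-irrefl : ∀ {x} → ¬ x ∼ x
  ∼-irrefl {x} x∼x = true≢false (trans (sym x∼x) (adj-irrefl G x))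

  ∼⇒CAdj : ∀ {x y} → fibre x ≢ fibre y → x ∼ y → CAdj Q x y
  ∼⇒CAdj {x} {y} fx≢fy = proj₁ (proj₁ ext x y fx≢fy)

  CAdj⇒∼ : ∀ {x y} → fibre x ≢ fibre y → CAdj Q x y → x ∼ y
  CAdj⇒∼ {x} {y} fx≢fy = proj₂ (proj₁ ext x y fx≢fy)

  ∼-uniqueInFibre : ∀ {x u v} → fibre x ≢ fibre u → fibre u ≡ fibre v → x ∼ u → x ∼ v → u ≡ v
  ∼-uniqueInFibre fx≢fu fu≡fv x∼u x∼v =
    CAdj-unique (∼⇒CAdj fx≢fu x∼u) (∼⇒CAdj (fx≢fu ∘ (λ e → trans e (sym fu≡fv))) x∼v) fu≡fv

  φ : Vecn n → Bool → Vecn n → Fin (2 ^ n)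
  φ a i = proj₁ (proj₂ ext a i)

  φ-injective : ∀ a i {α β} → φ a i α ≡ φ a i β → α ≡ β
  φ-injective a i = proj₁ (proj₁ (proj₂ (proj₂ ext a i)))

  ψ : Vecn n → Bool → Fin (2 ^ n) → Vecn n
  ψ a i u = proj₁ (proj₂ (proj₁ (proj₂ (proj₂ ext a i))) u)

  φ∘ψ : ∀ a i u → φ a i (ψ a i u) ≡ u
  φ∘ψ a i u = proj₂ (proj₂ (proj₁ (proj₂ (proj₂ ext a i))) u) refl

  adj-withinFibre : ∀ a i α β → adj G (a , i , α) (a , i , β) ≡ adj H (φ a i α) (φ a i β)
  adj-withinFibre a i = proj₂ (proj₂ (proj₂ ext a i))

  adj-copy : ∀ a i u w → adj G (a , i , ψ a i u) (a , i , ψ a i w) ≡ adj H u w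
  adj-copy a i u w = trans (adj-withinFibre a i _ _) (cong₂ (adj H) (φ∘ψ a i u) (φ∘ψ a i w))

  H-edge : ∃ λ u → ∃ λ w → adj H u w ≡ true
  H-edge with proj₂ H-diameter2
  ... | u , w , u≢w , _ with proj₁ H-diameter2 u w u≢w
  ...   | inj₁ u∼w           = u , w , u∼w
  ...   | inj₂ (v , u∼v , _) = u , v , u∼v

  notStar : ¬ IsStar G
  notStar ((a , i , _) , _ , leaves-independent) with H-edge
  ... | u , w , u∼w = true≢false (trans (sym copied) (leaves-independent _ _ off-centre off-centre))
    where
      copied : adj G (a , not i , ψ a (not i) u) (a , not i , ψ a (not i) w) ≡ true
      copied = trans (adj-copy a (not i) u w) u∼w

      off-centre : ∀ {α γ} → (a , not i , α) ≢ (a , i , γ)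
      off-centre e = not-¬ refl (sym (cong (proj₁ ∘ proj₂) e))

  distance≤2 : ∀ x y → x ≢ y → x ∼ y ⊎ ∃ λ z → x ∼ z × z ∼ y
  distance≤2 x@(a , i , α) y@(b , j , β) x≢y with (a , i) ≟ᶠ (b , j)
  ... | no fx≢fy with CAdj-distance≤2 crooked {x} {y} fx≢fy
  ...   | inj₁ x∼y                          = inj₁ (CAdj⇒∼ fx≢fy x∼y)
  ...   | inj₂ (z , fx≢fz , fz≢fy , x∼z , z∼y) = inj₂ (z , CAdj⇒∼ fx≢fz x∼z , CAdj⇒∼ fz≢fy z∼y)
  distance≤2 (a , i , α) (a , i , β) x≢y | yes refl
    with proj₁ H-diameter2 (φ a i α) (φ a i β) (x≢y ∘ cong (λ γ → a , i , γ) ∘ φ-injective a i)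
  ... | inj₁ u∼w = inj₁ (trans (adj-withinFibre a i α β) u∼w)
  ... | inj₂ (v , u∼v , v∼w) = inj₂ ((a , i , ψ a i v)
        , trans (adj-withinFibre a i α _) (trans (cong (adj H (φ a i α)) (φ∘ψ a i v)) u∼v)
        , trans (adj-withinFibre a i _ β) (trans (cong (λ t → adj H t (φ a i β)) (φ∘ψ a i v)) v∼w))

  nonadjacentPair : ∃ λ x → ∃ λ y → x ≢ y × adj G x y ≡ false
  nonadjacentPair with proj₂ H-diameter2
  ... | u , w , u≢w , u≁w =
    (𝟎 , false , ψ 𝟎 false u) , (𝟎 , false , ψ 𝟎 false w)
    , (λ e → u≢w (trans (sym (φ∘ψ 𝟎 false u)) (trans (cong (φ 𝟎 false ∘ label) e) (φ∘ψ 𝟎 false w))))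
    , trans (adj-copy 𝟎 false u w) u≁w

  noSharedNeighbour : ∀ {x u v} → fibre u ≡ fibre v → fibre x ≢ fibre u → x ∼ u → x ∼ v → ¬ u ∼ v
  noSharedNeighbour {u = u} fu≡fv fx≢fu x∼u x∼v u∼v =
    ∼-irrefl (subst (u ∼_) (sym (∼-uniqueInFibre fx≢fu fu≡fv x∼u x∼v)) u∼v)

  triangleFree : TriangleFree G
  triangleFree x@(a , i , α) y@(b , j , β) z@(c , k , γ) (x∼y , y∼z , x∼z)
    with (a , i) ≟ᶠ (b , j) | (b , j) ≟ᶠ (c , k) | (a , i) ≟ᶠ (c , k)
  ... | yes refl   | yes refl   | _          =
    H-triangleFree (φ a i α) (φ a i β) (φ a i γ)
      ( trans (sym (adj-withinFibre a i α β)) x∼y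
      , trans (sym (adj-withinFibre a i β γ)) y∼z
      , trans (sym (adj-withinFibre a i α γ)) x∼z )
  ... | yes fx≡fy  | no  fy≢fz  | _          =
    noSharedNeighbour {z} fx≡fy (λ fz≡fx → fy≢fz (sym (trans fz≡fx fx≡fy))) (∼-sym x∼z) (∼-sym y∼z) x∼y
  ... | no  fx≢fy  | yes fy≡fz  | _          = noSharedNeighbour {x} fy≡fz fx≢fy x∼y x∼z y∼z
  ... | no  fx≢fy  | no  _      | yes fx≡fz  = noSharedNeighbour {y} fx≡fz (fx≢fy ∘ sym) (∼-sym x∼y) y∼z x∼z
  ... | no  fx≢fy  | no  fy≢fz  | no  fx≢fz  =
    CAdj-triangleFree crooked fx≢fy fx≢fz fy≢fz (∼⇒CAdj fx≢fy x∼y) (∼⇒CAdj fx≢fz x∼z) (∼⇒CAdj fy≢fz y∼z)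

  noK₂₅-withinFibre : ∀ {a i α β} (f : Fin 5 → CVertex n) → α ≢ β → (∀ {k l} → f k ≡ f l → k ≡ l) →
    (∀ k → f k ≢ (a , i , α) × f k ≢ (a , i , β) × (a , i , α) ∼ f k × (a , i , β) ∼ f k) → ⊥
  noK₂₅-withinFibre {a} {i} {α} {β} f α≢β f-injective spokes =
    H-noK₂₅ ( φ a i α , φ a i β , φ a i ∘ label ∘ f , α≢β ∘ φ-injective a i
            , (λ eq → f-injective (vertex-≡ (trans (inFibre _) (sym (inFibre _))) (φ-injective a i eq)))
            , λ k → let f≢x , f≢y , x∼f , y∼f = spokes k in
                (f≢x ∘ vertex-≡ (inFibre k) ∘ φ-injective a i) , (f≢y ∘ vertex-≡ (inFibre k) ∘ φ-injective a i)
                , trans (sym (adj-withinFibre a i α _)) (subst ((a , i , α) ∼_) (onFibre k) x∼f)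
                , trans (sym (adj-withinFibre a i β _)) (subst ((a , i , β) ∼_) (onFibre k) y∼f) )
    where
      inFibre : ∀ k → fibre (f k) ≡ (a , i)
      inFibre k with fibre (f k) ≟ᶠ (a , i)
      ... | yes fk≡ = fk≡
      ... | no  fk≢ = let _ , _ , x∼f , y∼f = spokes k in
        ⊥-elim (α≢β (cong label (∼-uniqueInFibre {f k} fk≢ refl (∼-sym x∼f) (∼-sym y∼f))))

      onFibre : ∀ k → f k ≡ (a , i , label (f k))
      onFibre k = vertex-≡ (inFibre k) refl

  noK₂₅-acrossFibres : ∀ {x y} (f : Fin 5 → CVertex n) → fibre x ≢ fibre y → (∀ {k l} → f k ≡ f l → k ≡ l) →
    (∀ k → x ∼ f k × y ∼ f k) → ⊥
  noK₂₅-acrossFibres {x} {y} f fx≢fy f-injective spokes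
    with three-of-five (λ k → (fibre (f k) ≟ᶠ fibre x) ⊎-dec (fibre (f k) ≟ᶠ fibre y))
  ... | inj₁ three = ¬ThreeDistinct-⊎ (atMostOneSpokeIn {x} {y} (fx≢fy ∘ sym) (proj₂ ∘ spokes))
                                     (atMostOneSpokeIn {y} {x} fx≢fy (proj₁ ∘ spokes)) three
    where
      atMostOneSpokeIn : ∀ {w w′} → fibre w′ ≢ fibre w → (∀ k → w′ ∼ f k) →
        ∀ {k l} → k ≢ l → fibre (f k) ≡ fibre w → fibre (f l) ≡ fibre w → ⊥
      atMostOneSpokeIn fw′≢fw w′∼f k≢l fk≡fw fl≡fw =
        k≢l (f-injective (∼-uniqueInFibre (λ e → fw′≢fw (trans e fk≡fw)) (trans fk≡fw (sym fl≡fw))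
                                          (w′∼f _) (w′∼f _)))
  ... | inj₂ (k₁ , k₂ , k₃ , k₁≢k₂ , k₁≢k₃ , k₂≢k₃ , out₁ , out₂ , out₃) =
    pathLabel-atMost2 crooked fx≢fy (label x ⊕ label y)
      ( fibre (f k₁) , fibre (f k₂) , fibre (f k₃)
      , apart k₁≢k₂ out₁ , apart k₁≢k₃ out₁ , apart k₂≢k₃ out₂
      , common out₁ , common out₂ , common out₃ )
    where
      Outside : Fin 5 → Set
      Outside k = ¬ (fibre (f k) ≡ fibre x ⊎ fibre (f k) ≡ fibre y)

      apart : ∀ {k l} → k ≢ l → Outside k → fibre (f k) ≢ fibre (f l)
      apart {k} {l} k≢l out fk≡fl =
        k≢l (f-injective (∼-uniqueInFibre (λ e → out (inj₁ (sym e))) fk≡fl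
                                          (proj₁ (spokes k)) (proj₁ (spokes l))))

      common : ∀ {k} → Outside k → pathLabel (fibre x) (fibre y) (fibre (f k)) ≡ label x ⊕ label y
      common {k} out = CAdj-commonNeighbour {x} {y} {f k}
        (∼⇒CAdj (λ e → out (inj₁ (sym e))) (proj₁ (spokes k)))
        (∼⇒CAdj (λ e → out (inj₂ (sym e))) (proj₂ (spokes k)))

  noK₂₅ : ¬ HasK2 G 5
  noK₂₅ (x@(a , i , α) , y@(b , j , β) , f , x≢y , f-injective , spokes) with (a , i) ≟ᶠ (b , j)
  ... | yes refl = noK₂₅-withinFibre {a} {i} {α} {β} f (x≢y ∘ cong (λ γ → a , i , γ)) f-injective spokes
  ... | no fx≢fy = noK₂₅-acrossFibres {x} {y} f fx≢fy f-injective
                     (λ k → let _ , _ , x∼f , y∼f = spokes k in x∼f , y∼f)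

lemma2p1 : (e : ℕ) → 1 ≤ e →
    (Q : Vecn (2 * e ∸ 1) → Vecn (2 * e ∸ 1)) → Crooked (2 * e ∸ 1) Q →
    (H : Graph (Fin (2 ^ (2 * e ∸ 1)))) → InW H 5 →
    (G'' : Graph (CVertex (2 * e ∸ 1))) → IsFibreExtension Q H G'' →
    InW G'' 5
lemma2p1 _ _ Q crooked H H∈𝒲₅ G ext = notStar , (distance≤2 , nonadjacentPair) , triangleFree , noK₂₅
  where open FibreExtension Q crooked H H∈𝒲₅ G ext
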